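{- Let $m,n\ge 2$, let $C$ be any maximal configuration on the $m\times n$ grid, and let $1\le l\le m$ be an integer. If $S=\{1,2,\dots,l\}\times\{1,2\}$, then $|C\cap S|\ge \frac{1}{2}|S|=l$. The same holds for $S=\{1,2,\dots,l\}\times\{n-1,n\}$.
   Context: The $m\times n$ grid is $[m]\times[n]=\{(i,j):1\le i\le m,\ 1\le j\le n\}$; $(i,j)$ is the lot in row $i$ and column $j$, rows counted from the north (row $1$ northernmost, row $m$ southernmost) and columns from the west (column $1$ westernmost). A configuration is a subset $C\subseteq[m]\times[n]$ (the occupied lots). A house at $(i,j)\in C$ is blocked from sunlight if $(i,j+1)$, $(i,j-1)$, $(i+1,j)$ all lie in the grid and are all occupied (lots outside the grid never obstruct sunlight). A configuration is permissible if no house in it is blocked; it is maximal if it is permissible and no permissible configuration strictly contains it. -}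

module Defs where

open import Data.Nat using (ℕ; zero; suc; _+_; _<_; _≤_; _≥_; _<ᵇ_; _≡ᵇ_; _∸_)
open import Data.Fin using (Fin; toℕ)
open import Data.Product using (_×_; Σ; _,_; ∃)
open import Data.Sum using (_⊎_)
open import Relation.Nullary using (¬_)
open import Relation.Binary.PropositionalEquality using (_≡_)

-- Lots are pairs (i , j) with i : Fin m (row, 0 = northernmost) and
-- j : Fin n (column, 0 = westernmost)..
-- A configuration (subset of the grid) is a Boolean-valued function.
open import Data.Bool using (Bool; true; false; T; if_then_else_; _∧_; _∨_)
open import Data.List using (List; map; allFin)
open import Data.Nat.ListAction using (sum)

Config : ℕ → ℕ → Set
Config m n = Fin m → Fin n → Bool

Occ : ∀ {m n} → Config m n → Fin m → Fin n → Set
Occ C i j = T (C i j)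

OccAt : ∀ {m n} → Config m n → ℕ → ℕ → Set
OccAt {m} {n} C r c =
  Σ (Fin m) λ i → Σ (Fin n) λ j → toℕ i ≡ r × toℕ j ≡ c × Occ C i j

Blocked : ∀ {m n} → Config m n → Fin m → Fin n → Set
Blocked C i j =
  Occ C i j ×
  OccAt C (toℕ i) (suc (toℕ j)) ×
  (Σ ℕ λ c → suc c ≡ toℕ j × OccAt C (toℕ i) c) ×
  OccAt C (suc (toℕ i)) (toℕ j)

Permissible : ∀ {m n} → Config m n → Set
Permissible C = ∀ i j → ¬ Blocked C i j

_⊑_ : ∀ {m n} → Config m n → Config m n → Set
C ⊑ D = ∀ i j → Occ C i j → Occ D i j

Maximal : ∀ {m n} → Config m n → Set
Maximal C = Permissible C × (∀ D → Permissible D → C ⊑ D → D ⊑ C)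

b2n : Bool → ℕ
b2n true = 1
b2n false = 0

-- |C ∩ S| where S = {rows with 0-based index < l} × {columns with 0-based
-- index c₁ or c₂}  (c₁ ≢ c₂ in all uses).
count : ∀ {m n} → Config m n → ℕ → ℕ → ℕ → ℕ
count {m} {n} C l c₁ c₂ =
  sum (map (λ i → sum (map (λ j →
      if (toℕ i <ᵇ l) ∧ ((toℕ j ≡ᵇ c₁) ∨ (toℕ j ≡ᵇ c₂)) then b2n (C i j) else 0)
    (allFin n))) (allFin m))

{-# OPTIONS --safe #-}
-- In a maximal configuration every row meets each boundary pair of columns.
-- If the inner lot (i, 2) is empty, the outer lot (i, 1) can be added without
-- blocking anyone: a house in an outer column has no west (resp. east)
-- neighbour and so is never blocked, and the only other house that sees
-- (i, 1) is its row neighbour (i, 2), which is empty. Maximality then forces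
-- (i, 1) to be occupied already. Each of the rows 1, …, l thus contributes a
-- house to S.
module Submission where

open import Defs
open import Data.Bool using (T; true; if_then_else_; _∧_; _∨_)
open import Data.Bool.Properties using (T-∧; T-∨)
open import Data.Empty using (⊥; ⊥-elim)
open import Data.Fin using (Fin; toℕ; fromℕ; inject₁) renaming (zero to fzero; suc to fsuc)
open import Data.Fin.Properties using (_≟_; toℕ-injective; toℕ<n; toℕ-fromℕ; toℕ-inject₁)
open import Data.List using (List; _∷_; map; tabulate; allFin)
open import Data.List.Properties using (map-tabulate)
open import Data.List.Membership.Propositional using (_∈_)
open import Data.List.Membership.Propositional.Properties using (∈-allFin)
open import Data.List.Relation.Unary.Any using (here; there)
open import Data.Nat using (ℕ; zero; suc; _≤_; _<_; _∸_; _<ᵇ_; _≡ᵇ_; z≤n; s≤s)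
open import Data.Nat.ListAction using (sum)
open import Data.Nat.Properties using (≡⇒≡ᵇ; <⇒<ᵇ; ≤-refl; ≤-trans; m≤m+n; m≤n+m; +-mono-≤; <-irrefl; suc-injective)
open import Data.Product using (_×_; _,_; proj₁)
open import Data.Sum using (_⊎_; inj₁; inj₂; [_,_]′; swap)
open import Function using (id; _∘_; Equivalence)
open import Relation.Nullary using (¬_; Dec; yes; no)
open import Relation.Nullary.Decidable using (⌊_⌋; toWitness; fromWitness; T?)
open import Relation.Binary.PropositionalEquality using (_≡_; refl; sym; trans; cong; subst; module ≡-Reasoning)

open Equivalence using (to; from)

insert : ∀ {m n} → Config m n → Fin m → Fin n → Config m n
insert C i j i′ j′ = C i′ j′ ∨ (⌊ i′ ≟ i ⌋ ∧ ⌊ j′ ≟ j ⌋)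

Adjacent : ∀ {n} → Fin n → Fin n → Set
Adjacent j j′ = suc (toℕ j) ≡ toℕ j′ ⊎ suc (toℕ j′) ≡ toℕ j

module _ {m n} (C : Config m n) (i : Fin m) (j : Fin n) where

  occ-insert : ∀ {i′ j′} → Occ (insert C i j) i′ j′ → Occ C i′ j′ ⊎ (i′ ≡ i × j′ ≡ j)
  occ-insert {i′} {j′} o with to (T-∨ {C i′ j′}) o
  ... | inj₁ old = inj₁ old
  ... | inj₂ new with to (T-∧ {⌊ i′ ≟ i ⌋}) new
  ...   | i′≡i , j′≡j = inj₂ (toWitness {a? = i′ ≟ i} i′≡i , toWitness {a? = j′ ≟ j} j′≡j)

  occAt-insert : ∀ {r c} → OccAt (insert C i j) r c → OccAt C r c ⊎ (r ≡ toℕ i × c ≡ toℕ j)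
  occAt-insert (i′ , j′ , refl , refl , o) with occ-insert o
  ... | inj₁ old = inj₁ (i′ , j′ , refl , refl , old)
  ... | inj₂ (refl , refl) = inj₂ (refl , refl)

  ⊑-insert : C ⊑ insert C i j
  ⊑-insert i′ j′ = from (T-∨ {C i′ j′}) ∘ inj₁

  occ-inserted : Occ (insert C i j) i j
  occ-inserted = from (T-∨ {C i j}) (inj₂ (from (T-∧ {⌊ i ≟ i ⌋})
    (fromWitness {a? = i ≟ i} refl , fromWitness {a? = j ≟ j} refl)))

  maximal-absorbs : Maximal C → Permissible (insert C i j) → Occ C i j
  maximal-absorbs (_ , maximal) perm =
    maximal (insert C i j) perm ⊑-insert i j occ-inserted

insert-permissible : ∀ {m n} {C : Config m n} {i : Fin m} {j₀ j₁ : Fin n} →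
  Permissible C →
  (∀ i′ → ¬ Blocked (insert C i j₀) i′ j₀) →
  (∀ j → Adjacent j j₀ → j ≡ j₁) →
  ¬ Occ C i j₁ →
  Permissible (insert C i j₀)
insert-permissible {C = C} {i} {j₀} perm j₀-unblocked unique j₁-empty i′ j′ blocked =
  by-column (j′ ≟ j₀)
  where
  by-column : Dec (j′ ≡ j₀) → ⊥
  by-column (yes j′≡j₀) = j₀-unblocked i′ (subst (Blocked (insert C i j₀) i′) j′≡j₀ blocked)
  by-column (no j′≢j₀) = perm i′ j′ (survives blocked)
    where
    old : ∀ {r c} → OccAt (insert C i j₀) r c → ¬ (r ≡ toℕ i × c ≡ toℕ j₀) → OccAt C r c
    old o not-new = [ id , ⊥-elim ∘ not-new ]′ (occAt-insert C i j₀ o)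

    survives : Blocked (insert C i j₀) i′ j′ → Blocked C i′ j′
    survives (o , e , (c , c+1≡j′ , w) , s) =
      o′ , old e east , (c , c+1≡j′ , old w west) , old s south
      where
      o′ : Occ C i′ j′
      o′ = [ id , (λ { (_ , j′≡j₀) → ⊥-elim (j′≢j₀ j′≡j₀) }) ]′ (occ-insert C i j₀ o)

      row-neighbour : toℕ i′ ≡ toℕ i → ¬ Adjacent j′ j₀
      row-neighbour i′≡i adj with toℕ-injective i′≡i | unique j′ adj
      ... | refl | refl = j₁-empty o′

      east : ¬ (toℕ i′ ≡ toℕ i × suc (toℕ j′) ≡ toℕ j₀)
      east (i′≡i , j′+1≡j₀) = row-neighbour i′≡i (inj₁ j′+1≡j₀)

      west : ¬ (toℕ i′ ≡ toℕ i × c ≡ toℕ j₀)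
      west (i′≡i , c≡j₀) = row-neighbour i′≡i (inj₂ (trans (cong suc (sym c≡j₀)) c+1≡j′))

      south : ¬ (suc (toℕ i′) ≡ toℕ i × toℕ j′ ≡ toℕ j₀)
      south (_ , j′≡j₀) = j′≢j₀ (toℕ-injective j′≡j₀)

maximal-occupies-pair : ∀ {m n} {C : Config m n} {j₀ j₁ : Fin n} →
  Maximal C →
  (∀ (D : Config m n) i → ¬ Blocked D i j₀) →
  (∀ j → Adjacent j j₀ → j ≡ j₁) →
  ∀ i → Occ C i j₀ ⊎ Occ C i j₁
maximal-occupies-pair {C = C} {j₀} {j₁} max j₀-unblocked unique i with T? (C i j₁)
... | yes occ = inj₂ occ
... | no empty = inj₁ (maximal-absorbs C i j₀ max
        (insert-permissible (proj₁ max) (j₀-unblocked _) unique empty))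

westmost-unblocked : ∀ {m n} (C : Config m (suc n)) i → ¬ Blocked C i fzero
westmost-unblocked C i (_ , _ , (_ , () , _) , _)

eastmost-unblocked : ∀ {m n} (C : Config m (suc n)) i → ¬ Blocked C i (fromℕ n)
eastmost-unblocked {n = n} C i (_ , (_ , j , _ , j≡n+1 , _) , _) =
  <-irrefl (trans j≡n+1 (cong suc (toℕ-fromℕ n))) (toℕ<n j)

westmost-neighbour : ∀ {n} (j : Fin (suc (suc n))) → Adjacent j fzero → j ≡ fsuc fzero
westmost-neighbour j (inj₂ 1≡j) = toℕ-injective (sym 1≡j)

eastmost-neighbour : ∀ {n} (j : Fin (suc (suc n))) →
  Adjacent j (fromℕ (suc n)) → j ≡ inject₁ (fromℕ n)
eastmost-neighbour {n} j (inj₁ j+1≡n+1) = toℕ-injective (begin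
  toℕ j                   ≡⟨ suc-injective (trans j+1≡n+1 (toℕ-fromℕ (suc n))) ⟩
  n                       ≡⟨ sym (toℕ-fromℕ n) ⟩
  toℕ (fromℕ n)           ≡⟨ sym (toℕ-inject₁ (fromℕ n)) ⟩
  toℕ (inject₁ (fromℕ n)) ∎)
  where open ≡-Reasoning
eastmost-neighbour {n} j (inj₂ n+2≡j) =
  ⊥-elim (<-irrefl (trans (sym n+2≡j) (cong suc (toℕ-fromℕ (suc n)))) (toℕ<n j))

∈⇒≤sum-map : ∀ {A : Set} (f : A → ℕ) {x : A} {xs : List A} → x ∈ xs → f x ≤ sum (map f xs)
∈⇒≤sum-map f {xs = y ∷ _} (here refl) = m≤m+n (f y) _
∈⇒≤sum-map f {xs = y ∷ _} (there x∈ys) = ≤-trans (∈⇒≤sum-map f x∈ys) (m≤n+m _ (f y))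

≤sum-tabulate : ∀ {m} (h : Fin m → ℕ) {l} → l ≤ m → (∀ i → toℕ i < l → 1 ≤ h i) →
  l ≤ sum (tabulate h)
≤sum-tabulate h {zero} _ _ = z≤n
≤sum-tabulate h {suc l} (s≤s l≤m) positive =
  +-mono-≤ (positive fzero (s≤s z≤n))
           (≤sum-tabulate (h ∘ fsuc) l≤m (λ i i<l → positive (fsuc i) (s≤s i<l)))

count-lower-bound : ∀ {m n} (C : Config m n) {l a b} {ja jb : Fin n} →
  toℕ ja ≡ a → toℕ jb ≡ b → l ≤ m →
  (∀ i → toℕ i < l → Occ C i ja ⊎ Occ C i jb) →
  l ≤ count C l a b
count-lower-bound {m} {n} C {l} {a} {b} {ja} {jb} ja≡a jb≡b l≤m occupied =
  subst (l ≤_) (cong sum (sym (map-tabulate id row-count)))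
        (≤sum-tabulate row-count l≤m row-count-positive)
  where
  entry : Fin m → Fin n → ℕ
  entry i j = if (toℕ i <ᵇ l) ∧ ((toℕ j ≡ᵇ a) ∨ (toℕ j ≡ᵇ b)) then b2n (C i j) else 0

  row-count : Fin m → ℕ
  row-count i = sum (map (entry i) (allFin n))

  counted : ∀ {i j} → toℕ i < l → T ((toℕ j ≡ᵇ a) ∨ (toℕ j ≡ᵇ b)) → Occ C i j → 1 ≤ entry i j
  counted {i} {j} i<l column occ = one-if (from T-∧ (<⇒<ᵇ i<l , column)) occ
    where
    one-if : ∀ {p c} → T p → T c → 1 ≤ (if p then b2n c else 0)
    one-if {true} {true} _ _ = ≤-refl

  row-count-positive : ∀ i → toℕ i < l → 1 ≤ row-count i
  row-count-positive i i<l with occupied i i<l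
  ... | inj₁ occ = ≤-trans (counted i<l (from T-∨ (inj₁ (≡⇒≡ᵇ _ _ ja≡a))) occ)
                           (∈⇒≤sum-map (entry i) (∈-allFin ja))
  ... | inj₂ occ = ≤-trans (counted i<l (from T-∨ (inj₂ (≡⇒≡ᵇ _ _ jb≡b))) occ)
                           (∈⇒≤sum-map (entry i) (∈-allFin jb))

lemma4p2 : (m n : ℕ) → 2 ≤ m → 2 ≤ n → (C : Config m n) → Maximal C →
    (l : ℕ) → 1 ≤ l → l ≤ m →
    (l ≤ count C l 0 1) × (l ≤ count C l (n ∸ 2) (n ∸ 1))
lemma4p2 m (suc (suc k)) _ (s≤s (s≤s z≤n)) C max l _ l≤m =
  count-lower-bound C refl refl l≤m (λ i _ → west i) ,
  count-lower-bound C j₁≡k (toℕ-fromℕ (suc k)) l≤m (λ i _ → swap (east i))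
  where
  west : ∀ i → Occ C i fzero ⊎ Occ C i (fsuc fzero)
  west = maximal-occupies-pair max westmost-unblocked westmost-neighbour

  east : ∀ i → Occ C i (fromℕ (suc k)) ⊎ Occ C i (inject₁ (fromℕ k))
  east = maximal-occupies-pair max eastmost-unblocked eastmost-neighbour

  j₁≡k : toℕ (inject₁ (fromℕ k)) ≡ k
  j₁≡k = trans (toℕ-inject₁ (fromℕ k)) (toℕ-fromℕ k)
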